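{- Let $n \ge k \ge r \ge 2$ be integers and let $\mathcal{H}$ be a $k$-colorable $r$-graph on $n$ vertices without isolated vertices satisfying \[ \delta_{r-1}^{+}(\mathcal{H}) > \max\left\{\frac{3k-3r+1}{3k-2}\, n,\ \frac{k-r+1}{k+2}\, n\right\}. \] Let $\varphi\in\mathrm{Hom}(\mathcal{H},K_k^r)$, $i\in[k]$, and $v\in\varphi^{ -1}(i)$. Write $J_\varphi = \{j\in[k] : |\varphi^{ -1}(j)| \ge \frac{3n}{3k-2}\}$ and $\overline{J_\varphi}=[k]\setminus J_\varphi$. Then: (i) If $i\in J_\varphi$, then for every $(r-|J_\varphi|)$-set $I\subseteq \overline{J_\varphi}$ there exists an edge $e\in\mathcal{H}$ containing $v$ with $\varphi(e) = J_\varphi\cup I$. (ii) If $i\in \overline{J_\varphi}$, then for every $(r-1-|J_\varphi|)$-set $I\subseteq \overline{J_\varphi}\setminus\{i\}$ there exists an edge $e\in\mathcal{H}$ containing $v$ with $\varphi(e) = J_\varphi\cup I\cup\{i\}$. (iii) For every $j\in[k]\setminus\{i\}$ there exists an edge $e\in\mathcal{H}$ containing $v$ such that $j\in\varphi(e)$ and $|\varphi^{ -1}(\ell)| \ge |\varphi^{ -1}(\ell')|$ for every $\ell\in\varphi(e)\setminus\{i,j\}$ and every $\ell'\in[k]\setminus\varphi(e)$. (iv) If $J_\varphi=\emptyset$, then for every $(r-1)$-set $I\subseteq[k]$ there exists an edge $e\in\mathcal{H}$ containing $v$ with $I\subseteq\varphi(e)$.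
   Context: An $r$-graph $\mathcal{H}$ is a collection of $r$-element subsets (edges) of a finite vertex set $V(\mathcal{H})$; a vertex is isolated if it lies in no edge. $\partial\mathcal{H}$ is the set of $(r-1)$-sets contained in some edge; for an $(r-1)$-set $S$, $d_{\mathcal{H}}(S)$ is the number of vertices $v$ with $S\cup\{v\}\in\mathcal{H}$, and $\delta^{+}_{r-1}(\mathcal{H})=\min\{d_{\mathcal{H}}(S): S\in\partial\mathcal{H}\}$. $\mathrm{Hom}(\mathcal{H},K_k^r)$ is the set of maps $\varphi:V(\mathcal{H})\to[k]$ that are injective on every edge; $\mathcal{H}$ is $k$-colorable if this set is nonempty. For $A\subseteq V(\mathcal{H})$, $\varphi(A)=\{\varphi(a): a\in A\}$. -}

module Defs where

open import Data.Nat using (ℕ; _+_; _*_; _∸_; _≤_; _<_)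
open import Data.Bool using (Bool; true; false; not; _∧_)
open import Data.Fin using (Fin)
open import Data.Fin.Properties using (any?; _≟_)
open import Data.Fin.Subset using (Subset; _∈_; _∉_; _⊆_; _∪_; ⁅_⁆; ∣_∣)
open import Data.Fin.Subset.Properties using (_∈?_)
open import Data.Vec using (tabulate; lookup)
open import Data.Product using (Σ; ∃; _×_; _,_)
open import Relation.Nullary.Decidable using (⌊_⌋; _×-dec_)
open import Relation.Binary.PropositionalEquality using (_≡_)

-- An edge set on vertex set Fin n: the characteristic function of a family
-- of subsets of Fin n (an "edge" is a subset e with H e ≡ true).
Hypergraph : ℕ → Set
Hypergraph n = Subset n → Bool

_∈E_ : ∀ {n} → Subset n → Hypergraph n → Set
e ∈E H = H e ≡ true

IsUniform : ∀ {n} → ℕ → Hypergraph n → Set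
IsUniform r H = ∀ e → e ∈E H → ∣ e ∣ ≡ r

NoIsolated : ∀ {n} → Hypergraph n → Set
NoIsolated {n} H = ∀ (v : Fin n) → Σ (Subset n) λ e → e ∈E H × v ∈ e

InShadow : ∀ {n} → ℕ → Hypergraph n → Subset n → Set
InShadow r H S = ∣ S ∣ ≡ r ∸ 1 × Σ _ λ e → e ∈E H × S ⊆ e

degree : ∀ {n} → Hypergraph n → Subset n → ℕ
degree H S = ∣ tabulate (λ v → not (lookup S v) ∧ H (S ∪ ⁅ v ⁆)) ∣

-- φ ∈ Hom(H, K_k^r): injective on every edge
IsHom : ∀ {n k} → Hypergraph n → (Fin n → Fin k) → Set
IsHom H φ = ∀ e → e ∈E H → ∀ u w → u ∈ e → w ∈ e → φ u ≡ φ w → u ≡ w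

image : ∀ {n k} → (Fin n → Fin k) → Subset n → Subset k
image φ A = tabulate λ j → ⌊ any? (λ v → (v ∈? A) ×-dec (φ v ≟ j)) ⌋

classSize : ∀ {n k} → (Fin n → Fin k) → Fin k → ℕ
classSize φ j = ∣ tabulate (λ v → ⌊ φ v ≟ j ⌋) ∣

-- J_φ = { j : |φ⁻¹(j)| ≥ 3n/(3k-2) }, i.e. |φ⁻¹(j)|·(3k-2) ≥ 3n
Jset : ∀ {n k} → (Fin n → Fin k) → Subset k
Jset {n} {k} φ = tabulate λ j → ⌊ 3 * n ≤? classSize φ j * (3 * k ∸ 2) ⌋
  where open import Data.Nat using (_≤?_)

-- The engine is an exchange argument.  Fix a set T of r colours containing φ(v) and suppose that
-- every (r-1)-set of the shadow has more neighbours than there are vertices coloured outside T.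
-- Starting from any edge e through v, remove a vertex u coloured outside T: the neighbourhood of
-- e - u cannot lie entirely outside T, so some neighbour w coloured inside T gives an edge
-- (e - u) ∪ {w} with fewer vertices coloured outside T.  When none is left, φ maps e into T, and
-- by injectivity onto T.
--
-- In (i), (ii) and (iv) T contains J, so every colour outside T is light (fewer than 3n/(3k-2)
-- vertices) and the codegree bound yields the exchange condition.  In (iii) T consists of i, j and
-- the r - 2 heaviest remaining colours.  If the condition failed for T, the heaviest colour outside
-- T would be heavy, and with those r - 2 colours would form a set Q of r - 1 heavy colours avoiding
-- i.  Then so few vertices are coloured outside Q that an edge e through v with φ(e) = Q ∪ {i}
-- exists; but every neighbour of e - v is coloured outside Q, so e - v has too small a codegree.

module Submission where

open import Data.Bool using (Bool; true; false; not; _∧_)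
open import Data.Bool.Properties using (T-≡)
open import Data.Fin using (Fin; zero; suc)
open import Data.Fin.Properties using (_≟_; any?; suc-injective)
open import Data.Fin.Subset
  using (Subset; inside; outside; _∈_; _∉_; _⊆_; ⊥; ⊤; ⁅_⁆; ∁; _∪_; _∩_; _─_; _-_; ∣_∣; Nonempty)
open import Data.Fin.Subset.Properties
open import Data.List using (filter; allFin)
open import Data.List.Membership.Propositional.Properties using (∈-filter⁺; ∈-allFin)
open import Data.List.Relation.Unary.All as All using ()
open import Data.List.Relation.Unary.All.Properties using (all-filter)
open import Data.Nat using (ℕ; zero; suc; _+_; _*_; _∸_; _≤_; _<_; z≤n; s≤s; s≤s⁻¹)
open import Data.Nat.Properties hiding (_≟_; suc-injective)
open import Algebra.Properties.Semiring.Sum +-*-semiring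
  using (sum-syntax; sum-cong-≗; ∑-comm; *-distribʳ-sum)
open import Data.List.Extrema ≤-totalOrder using (argmax; argmax-all; f[xs]≤f[argmax])
open import Data.Product using (Σ; ∃; _×_; _,_; proj₁; proj₂)
open import Data.Sum using (inj₁; inj₂)
open import Data.Vec using ([]; _∷_; here; there; lookup; tabulate)
open import Data.Vec.Properties using (lookup∘tabulate; []=⇒lookup; lookup⇒[]=)
open import Defs
open import Function using (_∘_; case_of_; Equivalence)
open import Relation.Binary.PropositionalEquality
  using (_≡_; _≢_; refl; sym; trans; cong; cong₂; subst; module ≡-Reasoning)
open import Relation.Nullary using (yes; no; contradiction)
open import Relation.Nullary.Decidable using (⌊_⌋; _×-dec_; toWitness; fromWitness)
open import Relation.Unary using (Decidable)

private
  variable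
    m n k : ℕ

-- Subsets of Fin m

∣p∪q∣+∣p∩q∣≡∣p∣+∣q∣ : ∀ (p q : Subset m) → ∣ p ∪ q ∣ + ∣ p ∩ q ∣ ≡ ∣ p ∣ + ∣ q ∣
∣p∪q∣+∣p∩q∣≡∣p∣+∣q∣ []            []            = refl
∣p∪q∣+∣p∩q∣≡∣p∣+∣q∣ (inside ∷ p)  (inside ∷ q)  = cong suc (begin
  ∣ p ∪ q ∣ + suc ∣ p ∩ q ∣  ≡⟨ +-suc _ _ ⟩
  suc (∣ p ∪ q ∣ + ∣ p ∩ q ∣) ≡⟨ cong suc (∣p∪q∣+∣p∩q∣≡∣p∣+∣q∣ p q) ⟩
  suc (∣ p ∣ + ∣ q ∣)         ≡⟨ +-suc _ _ ⟨
  ∣ p ∣ + suc ∣ q ∣           ∎)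
  where open ≡-Reasoning
∣p∪q∣+∣p∩q∣≡∣p∣+∣q∣ (inside ∷ p)  (outside ∷ q) = cong suc (∣p∪q∣+∣p∩q∣≡∣p∣+∣q∣ p q)
∣p∪q∣+∣p∩q∣≡∣p∣+∣q∣ (outside ∷ p) (inside ∷ q)  = trans (cong suc (∣p∪q∣+∣p∩q∣≡∣p∣+∣q∣ p q)) (sym (+-suc _ _))
∣p∪q∣+∣p∩q∣≡∣p∣+∣q∣ (outside ∷ p) (outside ∷ q) = ∣p∪q∣+∣p∩q∣≡∣p∣+∣q∣ p q

∣p∪q∣≤∣p∣+∣q∣ : ∀ (p q : Subset m) → ∣ p ∪ q ∣ ≤ ∣ p ∣ + ∣ q ∣
∣p∪q∣≤∣p∣+∣q∣ p q = m+n≤o⇒m≤o ∣ p ∪ q ∣ (≤-reflexive (∣p∪q∣+∣p∩q∣≡∣p∣+∣q∣ p q))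

Disjoint : Subset m → Subset m → Set
Disjoint p q = ∀ {x} → x ∈ p → x ∉ q

∣p∪q∣≡∣p∣+∣q∣ : ∀ {p q : Subset m} → Disjoint p q → ∣ p ∪ q ∣ ≡ ∣ p ∣ + ∣ q ∣
∣p∪q∣≡∣p∣+∣q∣ {m} {p} {q} p#q = begin
  ∣ p ∪ q ∣                ≡⟨ +-identityʳ _ ⟨
  ∣ p ∪ q ∣ + 0            ≡⟨ cong (∣ p ∪ q ∣ +_) (∣⊥∣≡0 m) ⟨
  ∣ p ∪ q ∣ + ∣ ⊥ {m} ∣    ≡⟨ cong (λ s → ∣ p ∪ q ∣ + ∣ s ∣) p∩q≡⊥ ⟨
  ∣ p ∪ q ∣ + ∣ p ∩ q ∣    ≡⟨ ∣p∪q∣+∣p∩q∣≡∣p∣+∣q∣ p q ⟩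
  ∣ p ∣ + ∣ q ∣            ∎
  where
  open ≡-Reasoning
  p∩q≡⊥ : p ∩ q ≡ ⊥
  p∩q≡⊥ = Empty-unique λ (x , x∈p∩q) → let x∈p , x∈q = x∈p∩q⁻ p q x∈p∩q in p#q x∈p x∈q

x∉p⇒∣p∪⁅x⁆∣≡1+∣p∣ : ∀ {p : Subset m} {x} → x ∉ p → ∣ p ∪ ⁅ x ⁆ ∣ ≡ suc ∣ p ∣
x∉p⇒∣p∪⁅x⁆∣≡1+∣p∣ {p = p} {x} x∉p = begin
  ∣ p ∪ ⁅ x ⁆ ∣       ≡⟨ ∣p∪q∣≡∣p∣+∣q∣ (λ y∈p y∈⁅x⁆ → x∉p (subst (_∈ p) (x∈⁅y⁆⇒x≡y x y∈⁅x⁆) y∈p)) ⟩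
  ∣ p ∣ + ∣ ⁅ x ⁆ ∣   ≡⟨ cong (∣ p ∣ +_) (∣⁅x⁆∣≡1 x) ⟩
  ∣ p ∣ + 1           ≡⟨ +-comm ∣ p ∣ 1 ⟩
  suc ∣ p ∣           ∎
  where open ≡-Reasoning

x∈p─q⇒x∉q : ∀ (p q : Subset m) {x} → x ∈ p ─ q → x ∉ q
x∈p─q⇒x∉q (_ ∷ p) (outside ∷ q) here          ()
x∈p─q⇒x∉q (_ ∷ p) (inside ∷ q)  {zero} ()
x∈p─q⇒x∉q (_ ∷ p) (_ ∷ q)       (there x∈p─q) = x∈p─q⇒x∉q p q x∈p─q ∘ drop-there

x∈p-y⇒x≢y : ∀ (p : Subset m) {x y} → x ∈ p - y → x ≢ y
x∈p-y⇒x≢y p {y = y} x∈p-y refl = x∈p─q⇒x∉q p ⁅ y ⁆ x∈p-y (x∈⁅x⁆ y)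

x∈p⇒∣p∣≡1+∣p-x∣ : ∀ {p : Subset m} {x} → x ∈ p → ∣ p ∣ ≡ suc ∣ p - x ∣
x∈p⇒∣p∣≡1+∣p-x∣ {p = inside ∷ p}  here          = cong (suc ∘ ∣_∣) (sym (p─⊥≡p p))
x∈p⇒∣p∣≡1+∣p-x∣ {p = inside ∷ p}  (there x∈p) = cong suc (x∈p⇒∣p∣≡1+∣p-x∣ x∈p)
x∈p⇒∣p∣≡1+∣p-x∣ {p = outside ∷ p} (there x∈p) = x∈p⇒∣p∣≡1+∣p-x∣ x∈p

p⊆q⇒∣q∣≤∣p∣⇒p≡q : ∀ {p q : Subset m} → p ⊆ q → ∣ q ∣ ≤ ∣ p ∣ → p ≡ q
p⊆q⇒∣q∣≤∣p∣⇒p≡q {p = []}          {[]}          _   _           = refl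
p⊆q⇒∣q∣≤∣p∣⇒p≡q {p = inside ∷ p}  {inside ∷ q}  p⊆q (s≤s q≤p) =
  cong (inside ∷_) (p⊆q⇒∣q∣≤∣p∣⇒p≡q (drop-∷-⊆ p⊆q) q≤p)
p⊆q⇒∣q∣≤∣p∣⇒p≡q {p = outside ∷ p} {outside ∷ q} p⊆q q≤p       =
  cong (outside ∷_) (p⊆q⇒∣q∣≤∣p∣⇒p≡q (drop-∷-⊆ p⊆q) q≤p)
p⊆q⇒∣q∣≤∣p∣⇒p≡q {p = inside ∷ p}  {outside ∷ q} p⊆q _ with p⊆q here
... | ()
p⊆q⇒∣q∣≤∣p∣⇒p≡q {p = outside ∷ p} {inside ∷ q}  p⊆q q<p       =
  contradiction (p⊆q⇒∣p∣≤∣q∣ (drop-∷-⊆ p⊆q)) (<⇒≱ q<p)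

∣p∣<∣q∣⇒q∩∁p≢∅ : ∀ (p q : Subset m) → ∣ p ∣ < ∣ q ∣ → Nonempty (q ∩ ∁ p)
∣p∣<∣q∣⇒q∩∁p≢∅ p q ∣p∣<∣q∣ with nonempty? (q ∩ ∁ p)
... | yes q∩∁p≢∅ = q∩∁p≢∅
... | no  q∩∁p≡∅ = contradiction (p⊆q⇒∣p∣≤∣q∣ q⊆p) (<⇒≱ ∣p∣<∣q∣)
  where
  q⊆p : q ⊆ p
  q⊆p {x} x∈q = x∉∁p⇒x∈p λ x∈∁p → q∩∁p≡∅ (x , x∈p∩q⁺ (x∈q , x∈∁p))

⊆-extend : ∀ (p : Subset m) d → ∣ p ∣ + d ≤ m → ∃ λ q → p ⊆ q × ∣ q ∣ ≡ ∣ p ∣ + d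
⊆-extend p zero    _     = p , ⊆-refl , sym (+-identityʳ _)
⊆-extend {m} p (suc d) bound = q , p∪x⊆q ∘ p⊆p∪q ⁅ x ⁆ , ∣q∣≡
  where
  outside-p = ∣p∣<∣q∣⇒q∩∁p≢∅ p ⊤ (subst (∣ p ∣ <_) (sym (∣⊤∣≡n m)) (≤-trans (m<m+n ∣ p ∣ (s≤s z≤n)) bound))
  x = proj₁ outside-p
  x∉p : x ∉ p
  x∉p = x∈∁p⇒x∉p (proj₂ (x∈p∩q⁻ ⊤ (∁ p) (proj₂ outside-p)))
  ∣p∪x∣≡ = x∉p⇒∣p∪⁅x⁆∣≡1+∣p∣ x∉p
  extended = ⊆-extend (p ∪ ⁅ x ⁆) d (subst (_≤ m) (trans (+-suc _ _) (cong (_+ d) (sym ∣p∪x∣≡))) bound)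
  q = proj₁ extended
  p∪x⊆q = proj₁ (proj₂ extended)
  ∣q∣≡ : ∣ q ∣ ≡ ∣ p ∣ + suc d
  ∣q∣≡ = trans (proj₂ (proj₂ extended)) (trans (cong (_+ d) ∣p∪x∣≡) (sym (+-suc _ _)))

module _ {P : Fin m → Set} (P? : Decidable P) where

  ∈-tabulate⌊⌋⁺ : ∀ {x} → P x → x ∈ tabulate (λ y → ⌊ P? y ⌋)
  ∈-tabulate⌊⌋⁺ {x} Px =
    lookup⇒[]= x _ (trans (lookup∘tabulate _ x) (Equivalence.to T-≡ (fromWitness Px)))

  ∈-tabulate⌊⌋⁻ : ∀ {x} → x ∈ tabulate (λ y → ⌊ P? y ⌋) → P x
  ∈-tabulate⌊⌋⁻ {x} x∈ =
    toWitness (Equivalence.from T-≡ (trans (sym (lookup∘tabulate _ x)) ([]=⇒lookup x∈)))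

argmax-on : ∀ (f : Fin m → ℕ) {R x} → x ∈ R → ∃ λ y → y ∈ R × (∀ {c} → c ∈ R → f c ≤ f y)
argmax-on {m} f {R} {x} x∈R = argmax f x candidates , argmax-all f x∈R (all-filter (_∈? R) (allFin m)) ,
  λ {c} c∈R → All.lookup (f[xs]≤f[argmax] x candidates) (∈-filter⁺ (_∈? R) (∈-allFin c) c∈R)
  where candidates = filter (_∈? R) (allFin m)

Heaviest : (Fin m → ℕ) → Subset m → Subset m → Set
Heaviest f R P = P ⊆ R × (∀ {c c′} → c ∈ P → c′ ∈ R → c′ ∉ P → f c′ ≤ f c)

heaviest : ∀ (f : Fin m → ℕ) R t → t ≤ ∣ R ∣ → ∃ λ P → Heaviest f R P × ∣ P ∣ ≡ t
heaviest {m} f R zero _ = ⊥ , (⊥⊆ , λ c∈⊥ → contradiction c∈⊥ ∉⊥) , ∣⊥∣≡0 m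
heaviest f R (suc t) t<∣R∣ = P ∪ ⁅ y ⁆ , (P∪y⊆R , P∪y-heaviest) , ∣P∪y∣≡1+t
  where
  previous = heaviest f R t (<⇒≤ t<∣R∣)
  P = proj₁ previous
  P⊆R = proj₁ (proj₁ (proj₂ previous))
  P-heaviest = proj₂ (proj₁ (proj₂ previous))
  ∣P∣≡t = proj₂ (proj₂ previous)
  R∖P≢∅ = ∣p∣<∣q∣⇒q∩∁p≢∅ P R (subst (_< ∣ R ∣) (sym ∣P∣≡t) t<∣R∣)
  best = argmax-on f (proj₂ R∖P≢∅)
  y = proj₁ best
  y∈R = proj₁ (x∈p∩q⁻ R (∁ P) (proj₁ (proj₂ best)))
  y∉P = x∈∁p⇒x∉p (proj₂ (x∈p∩q⁻ R (∁ P) (proj₁ (proj₂ best))))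
  y-max = proj₂ (proj₂ best)
  P∪y⊆R : P ∪ ⁅ y ⁆ ⊆ R
  P∪y⊆R c∈ with x∈p∪q⁻ P ⁅ y ⁆ c∈
  ... | inj₁ c∈P = P⊆R c∈P
  ... | inj₂ c∈⁅y⁆ rewrite x∈⁅y⁆⇒x≡y y c∈⁅y⁆ = y∈R
  P∪y-heaviest : ∀ {c c′} → c ∈ P ∪ ⁅ y ⁆ → c′ ∈ R → c′ ∉ P ∪ ⁅ y ⁆ → f c′ ≤ f c
  P∪y-heaviest c∈ c′∈R c′∉ with x∈p∪q⁻ P ⁅ y ⁆ c∈
  ... | inj₁ c∈P = P-heaviest c∈P c′∈R (c′∉ ∘ p⊆p∪q ⁅ y ⁆)
  ... | inj₂ c∈⁅y⁆ rewrite x∈⁅y⁆⇒x≡y y c∈⁅y⁆ =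
    y-max (x∈p∩q⁺ (c′∈R , x∉p⇒x∈∁p (c′∉ ∘ p⊆p∪q ⁅ y ⁆)))
  ∣P∪y∣≡1+t : ∣ P ∪ ⁅ y ⁆ ∣ ≡ suc t
  ∣P∪y∣≡1+t = trans (x∉p⇒∣p∪⁅x⁆∣≡1+∣p∣ y∉P) (cong suc ∣P∣≡t)

-- Arithmetic of the degree threshold

[k∸r]*3x≤[3k+1∸3r]*x : ∀ k r x → (k ∸ r) * (3 * x) ≤ (3 * k + 1 ∸ 3 * r) * x
[k∸r]*3x≤[3k+1∸3r]*x k r x = begin
  (k ∸ r) * (3 * x)    ≡⟨ *-assoc (k ∸ r) 3 x ⟨
  (k ∸ r) * 3 * x      ≡⟨ cong (_* x) (trans (*-comm (k ∸ r) 3) (*-distribˡ-∸ 3 k r)) ⟩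
  (3 * k ∸ 3 * r) * x  ≤⟨ *-monoˡ-≤ x (∸-monoˡ-≤ (3 * r) (m≤m+n (3 * k) 1)) ⟩
  (3 * k + 1 ∸ 3 * r) * x ∎
  where open ≤-Reasoning

n*[3k∸2]≡[3k+1∸3r]*n+[r∸1]*3n : ∀ n k r → 1 ≤ r → r ≤ k →
  n * (3 * k ∸ 2) ≡ (3 * k + 1 ∸ 3 * r) * n + (r ∸ 1) * (3 * n)
n*[3k∸2]≡[3k+1∸3r]*n+[r∸1]*3n n k (suc r) _ r≤k with m≤n⇒∃[o]m+o≡n r≤k
... | t , refl = begin
  n * (3 * (suc r + t) ∸ 2)           ≡⟨ cong (λ c → n * (c ∸ 2)) (expand-M r t) ⟩
  n * (2 + (1 + 3 * r + 3 * t) ∸ 2)   ≡⟨ cong (n *_) (m+n∸m≡n 2 (1 + 3 * r + 3 * t)) ⟩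
  n * (1 + 3 * r + 3 * t)             ≡⟨ regroup n r t ⟩
  (3 * t + 1) * n + r * (3 * n)       ≡⟨ cong (λ c → c * n + r * (3 * n)) (m+n∸m≡n (3 * suc r) (3 * t + 1)) ⟨
  (3 * suc r + (3 * t + 1) ∸ 3 * suc r) * n + r * (3 * n)
                                      ≡⟨ cong (λ c → (c ∸ 3 * suc r) * n + r * (3 * n)) (expand-3k+1 r t) ⟩
  (3 * (suc r + t) + 1 ∸ 3 * suc r) * n + r * (3 * n) ∎
  where
  open ≡-Reasoning
  open import Data.Nat.Tactic.RingSolver using (solve-∀)
  expand-M : ∀ r t → 3 * (suc r + t) ≡ 2 + (1 + 3 * r + 3 * t)
  expand-M = solve-∀
  expand-3k+1 : ∀ r t → 3 * suc r + (3 * t + 1) ≡ 3 * (suc r + t) + 1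
  expand-3k+1 = solve-∀
  regroup : ∀ n r t → n * (1 + 3 * r + 3 * t) ≡ (3 * t + 1) * n + r * (3 * n)
  regroup = solve-∀

X*[3k∸2]≤[3k+1∸3r]*n : ∀ n k r {X a} → 1 ≤ r → r ≤ k →
  3 * n ≤ a * (3 * k ∸ 2) → X + (r ∸ 1) * a ≤ n → X * (3 * k ∸ 2) ≤ (3 * k + 1 ∸ 3 * r) * n
X*[3k∸2]≤[3k+1∸3r]*n n k r {X} {a} 1≤r r≤k 3n≤aM X+[r∸1]a≤n =
  +-cancelʳ-≤ ((r ∸ 1) * (3 * n)) (X * M) ((3 * k + 1 ∸ 3 * r) * n) (begin
    X * M + (r ∸ 1) * (3 * n)         ≤⟨ +-monoʳ-≤ (X * M) (*-monoʳ-≤ (r ∸ 1) 3n≤aM) ⟩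
    X * M + (r ∸ 1) * (a * M)         ≡⟨ cong (X * M +_) (*-assoc (r ∸ 1) a M) ⟨
    X * M + (r ∸ 1) * a * M           ≡⟨ *-distribʳ-+ M X ((r ∸ 1) * a) ⟨
    (X + (r ∸ 1) * a) * M             ≤⟨ *-monoˡ-≤ M X+[r∸1]a≤n ⟩
    n * M                             ≡⟨ n*[3k∸2]≡[3k+1∸3r]*n+[r∸1]*3n n k r 1≤r r≤k ⟩
    (3 * k + 1 ∸ 3 * r) * n + (r ∸ 1) * (3 * n) ∎)
  where
  open ≤-Reasoning
  M = 3 * k ∸ 2

-- Colour classes

𝟙 : Bool → ℕ
𝟙 true  = 1
𝟙 false = 0

∣p∣≡∑𝟙 : ∀ (p : Subset m) → ∣ p ∣ ≡ ∑[ x < m ] 𝟙 (lookup p x)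
∣p∣≡∑𝟙 []            = refl
∣p∣≡∑𝟙 (inside ∷ p)  = cong suc (∣p∣≡∑𝟙 p)
∣p∣≡∑𝟙 (outside ∷ p) = ∣p∣≡∑𝟙 p

∣tabulate∣≡∑𝟙 : ∀ (f : Fin m → Bool) → ∣ tabulate f ∣ ≡ ∑[ x < m ] 𝟙 (f x)
∣tabulate∣≡∑𝟙 f = trans (∣p∣≡∑𝟙 (tabulate f)) (sum-cong-≗ (cong 𝟙 ∘ lookup∘tabulate f))

∑-mono-≤ : ∀ {f g : Fin m → ℕ} → (∀ x → f x ≤ g x) → ∑[ x < m ] f x ≤ ∑[ x < m ] g x
∑-mono-≤ {zero}  _   = z≤n
∑-mono-≤ {suc m} f≤g = +-mono-≤ (f≤g zero) (∑-mono-≤ (f≤g ∘ suc))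

∑-δ : ∀ (x : Fin m) (g : Fin m → ℕ) → ∑[ y < m ] (𝟙 ⌊ x ≟ y ⌋ * g y) ≡ g x
∑-δ {suc m} zero    g = trans (cong₂ _+_ (+-identityʳ (g zero)) (∑-zero m)) (+-identityʳ _)
  where
  ∑-zero : ∀ m → ∑[ y < m ] 0 ≡ 0
  ∑-zero zero    = refl
  ∑-zero (suc m) = ∑-zero m
∑-δ {suc m} (suc x) g = trans (sum-cong-≗ λ y → cong (λ b → 𝟙 b * g (suc y)) (⌊suc≟suc⌋ y)) (∑-δ x (g ∘ suc))
  where
  ⌊suc≟suc⌋ : ∀ y → ⌊ suc x ≟ suc y ⌋ ≡ ⌊ x ≟ y ⌋
  ⌊suc≟suc⌋ y with x ≟ y
  ... | yes _ = refl
  ... | no  _ = refl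

infix 9 _⁻¹_

_⁻¹_ : (Fin n → Fin k) → Subset k → Subset n
φ ⁻¹ C = tabulate (λ v → lookup C (φ v))

module _ (φ : Fin n → Fin k) where

  ∈⁻¹⁺ : ∀ {C v} → φ v ∈ C → v ∈ φ ⁻¹ C
  ∈⁻¹⁺ {v = v} φv∈C = lookup⇒[]= v _ (trans (lookup∘tabulate _ v) ([]=⇒lookup φv∈C))

  ∈⁻¹⁻ : ∀ {C v} → v ∈ φ ⁻¹ C → φ v ∈ C
  ∈⁻¹⁻ {C} {v} v∈ = lookup⇒[]= (φ v) C (trans (sym (lookup∘tabulate _ v)) ([]=⇒lookup v∈))

  ⁻¹-mono : ∀ {C D} → C ⊆ D → φ ⁻¹ C ⊆ φ ⁻¹ D
  ⁻¹-mono C⊆D = ∈⁻¹⁺ ∘ C⊆D ∘ ∈⁻¹⁻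

  ⁻¹-∁ : ∀ C → φ ⁻¹ ∁ C ≡ ∁ (φ ⁻¹ C)
  ⁻¹-∁ C = ⊆-antisym (λ v∈ → x∉p⇒x∈∁p (x∈∁p⇒x∉p (∈⁻¹⁻ {∁ C} v∈) ∘ ∈⁻¹⁻ {C}))
                       (λ v∈ → ∈⁻¹⁺ {∁ C} (x∉p⇒x∈∁p (x∈∁p⇒x∉p v∈ ∘ ∈⁻¹⁺ {C})))

  ∣φ⁻¹C∣+∣φ⁻¹∁C∣≡n : ∀ C → ∣ φ ⁻¹ C ∣ + ∣ φ ⁻¹ ∁ C ∣ ≡ n
  ∣φ⁻¹C∣+∣φ⁻¹∁C∣≡n C = begin
    ∣ φ ⁻¹ C ∣ + ∣ φ ⁻¹ ∁ C ∣     ≡⟨ cong (λ p → ∣ φ ⁻¹ C ∣ + ∣ p ∣) (⁻¹-∁ C) ⟩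
    ∣ φ ⁻¹ C ∣ + ∣ ∁ (φ ⁻¹ C) ∣   ≡⟨ cong (∣ φ ⁻¹ C ∣ +_) (∣∁p∣≡n∸∣p∣ (φ ⁻¹ C)) ⟩
    ∣ φ ⁻¹ C ∣ + (n ∸ ∣ φ ⁻¹ C ∣) ≡⟨ m+[n∸m]≡n (∣p∣≤n (φ ⁻¹ C)) ⟩
    n                              ∎
    where open ≡-Reasoning

module _ (φ : Fin n → Fin k) (C : Subset k) where

  ∣φ⁻¹C∣≡∑classSize : ∣ φ ⁻¹ C ∣ ≡ ∑[ c < k ] (𝟙 (lookup C c) * classSize φ c)
  ∣φ⁻¹C∣≡∑classSize = begin
    ∣ φ ⁻¹ C ∣
      ≡⟨ ∣tabulate∣≡∑𝟙 (lookup C ∘ φ) ⟩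
    ∑[ v < n ] 𝟙 (lookup C (φ v))
      ≡⟨ sum-cong-≗ (λ v → ∑-δ (φ v) (𝟙 ∘ lookup C)) ⟨
    ∑[ v < n ] ∑[ c < k ] (𝟙 ⌊ φ v ≟ c ⌋ * 𝟙 (lookup C c))
      ≡⟨ ∑-comm (λ v c → 𝟙 ⌊ φ v ≟ c ⌋ * 𝟙 (lookup C c)) ⟩
    ∑[ c < k ] ∑[ v < n ] (𝟙 ⌊ φ v ≟ c ⌋ * 𝟙 (lookup C c))
      ≡⟨ sum-cong-≗ (λ c → *-distribʳ-sum (𝟙 (lookup C c)) (λ v → 𝟙 ⌊ φ v ≟ c ⌋)) ⟨
    ∑[ c < k ] (∑[ v < n ] 𝟙 ⌊ φ v ≟ c ⌋ * 𝟙 (lookup C c))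
      ≡⟨ sum-cong-≗ (λ c → trans (*-comm (𝟙 (lookup C c)) (classSize φ c))
                                  (cong (_* 𝟙 (lookup C c)) (∣tabulate∣≡∑𝟙 (λ v → ⌊ φ v ≟ c ⌋)))) ⟨
    ∑[ c < k ] (𝟙 (lookup C c) * classSize φ c)
      ∎
    where open ≡-Reasoning

  ∣φ⁻¹C∣*w≤∣C∣*b : ∀ {w b} → (∀ {c} → c ∈ C → classSize φ c * w ≤ b) → ∣ φ ⁻¹ C ∣ * w ≤ ∣ C ∣ * b
  ∣φ⁻¹C∣*w≤∣C∣*b {w} {b} bound = begin
    ∣ φ ⁻¹ C ∣ * w                                   ≡⟨ cong (_* w) ∣φ⁻¹C∣≡∑classSize ⟩
    ∑[ c < k ] (𝟙 (lookup C c) * classSize φ c) * w  ≡⟨ *-distribʳ-sum w (λ c → 𝟙 (lookup C c) * classSize φ c) ⟩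
    ∑[ c < k ] (𝟙 (lookup C c) * classSize φ c * w)  ≤⟨ ∑-mono-≤ termwise ⟩
    ∑[ c < k ] (𝟙 (lookup C c) * b)                  ≡⟨ *-distribʳ-sum b (𝟙 ∘ lookup C) ⟨
    ∑[ c < k ] 𝟙 (lookup C c) * b                    ≡⟨ cong (_* b) (∣p∣≡∑𝟙 C) ⟨
    ∣ C ∣ * b                                        ∎
    where
    open ≤-Reasoning
    termwise : ∀ c → 𝟙 (lookup C c) * classSize φ c * w ≤ 𝟙 (lookup C c) * b
    termwise c with lookup C c in c∈C
    ... | inside  rewrite *-identityˡ (classSize φ c) | +-identityʳ b = bound (lookup⇒[]= c C c∈C)
    ... | outside = z≤n

  ∣C∣*b≤∣φ⁻¹C∣ : ∀ {b} → (∀ {c} → c ∈ C → b ≤ classSize φ c) → ∣ C ∣ * b ≤ ∣ φ ⁻¹ C ∣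
  ∣C∣*b≤∣φ⁻¹C∣ {b} bound = begin
    ∣ C ∣ * b                                   ≡⟨ cong (_* b) (∣p∣≡∑𝟙 C) ⟩
    ∑[ c < k ] 𝟙 (lookup C c) * b               ≡⟨ *-distribʳ-sum b (𝟙 ∘ lookup C) ⟩
    ∑[ c < k ] (𝟙 (lookup C c) * b)             ≤⟨ ∑-mono-≤ termwise ⟩
    ∑[ c < k ] (𝟙 (lookup C c) * classSize φ c) ≡⟨ ∣φ⁻¹C∣≡∑classSize ⟨
    ∣ φ ⁻¹ C ∣                                  ∎
    where
    open ≤-Reasoning
    termwise : ∀ c → 𝟙 (lookup C c) * b ≤ 𝟙 (lookup C c) * classSize φ c
    termwise c with lookup C c in c∈C
    ... | inside  = +-monoˡ-≤ 0 (bound (lookup⇒[]= c C c∈C))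
    ... | outside = z≤n

module _ (φ : Fin n → Fin k) where

  ∉Jset⇒light : ∀ {c} → c ∉ Jset φ → classSize φ c * (3 * k ∸ 2) < 3 * n
  ∉Jset⇒light c∉J = ≰⇒> (c∉J ∘ ∈-tabulate⌊⌋⁺ (λ j → 3 * n ≤? classSize φ j * (3 * k ∸ 2)))

  light-outside : ∀ {r T} → ∣ T ∣ ≡ r → (∀ {c} → c ∉ T → c ∉ Jset φ) →
                  ∣ φ ⁻¹ ∁ T ∣ * (3 * k ∸ 2) ≤ (3 * k + 1 ∸ 3 * r) * n
  light-outside {r} {T} ∣T∣≡r J⊆T = begin
    ∣ φ ⁻¹ ∁ T ∣ * (3 * k ∸ 2) ≤⟨ ∣φ⁻¹C∣*w≤∣C∣*b φ (∁ T) (<⇒≤ ∘ ∉Jset⇒light ∘ J⊆T ∘ x∈∁p⇒x∉p) ⟩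
    ∣ ∁ T ∣ * (3 * n)          ≡⟨ cong (_* (3 * n)) (trans (∣∁p∣≡n∸∣p∣ T) (cong (k ∸_) ∣T∣≡r)) ⟩
    (k ∸ r) * (3 * n)          ≤⟨ [k∸r]*3x≤[3k+1∸3r]*x k r n ⟩
    (3 * k + 1 ∸ 3 * r) * n    ∎
    where open ≤-Reasoning

-- Images of edges

InjectiveOn : (Fin n → Fin k) → Subset n → Set
InjectiveOn φ e = ∀ u w → u ∈ e → w ∈ e → φ u ≡ φ w → u ≡ w

module _ {φ : Fin n → Fin k} {e : Subset n} where

  ∈-image⁺ : ∀ {v} → v ∈ e → φ v ∈ image φ e
  ∈-image⁺ {v} v∈e = ∈-tabulate⌊⌋⁺ (λ c → any? (λ u → (u ∈? e) ×-dec (φ u ≟ c))) (v , v∈e , refl)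

  ∈-image⁻ : ∀ {c} → c ∈ image φ e → ∃ λ v → v ∈ e × φ v ≡ c
  ∈-image⁻ = ∈-tabulate⌊⌋⁻ (λ c → any? (λ u → (u ∈? e) ×-dec (φ u ≟ c)))

  image⊆ : ∀ {T} → (∀ {v} → v ∈ e → φ v ∈ T) → image φ e ⊆ T
  image⊆ φ[e]⊆T c∈ with ∈-image⁻ c∈
  ... | v , v∈e , refl = φ[e]⊆T v∈e

injective-tail : ∀ (φ : Fin (suc n) → Fin k) {s e} → InjectiveOn φ (s ∷ e) → InjectiveOn (φ ∘ suc) e
injective-tail φ inj u w u∈e w∈e φsu≡φsw =
  suc-injective (inj (suc u) (suc w) (there u∈e) (there w∈e) φsu≡φsw)

module _ (φ : Fin (suc n) → Fin k) (e : Subset n) where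

  image-outside∷ : image φ (outside ∷ e) ≡ image (φ ∘ suc) e
  image-outside∷ = ⊆-antisym drop-outside (image⊆ (∈-image⁺ ∘ there))
    where
    drop-outside : image φ (outside ∷ e) ⊆ image (φ ∘ suc) e
    drop-outside c∈ with ∈-image⁻ c∈
    ... | suc v , there v∈e , refl = ∈-image⁺ v∈e

  image-inside∷ : image φ (inside ∷ e) ≡ ⁅ φ zero ⁆ ∪ image (φ ∘ suc) e
  image-inside∷ = ⊆-antisym split join
    where
    split : image φ (inside ∷ e) ⊆ ⁅ φ zero ⁆ ∪ image (φ ∘ suc) e
    split c∈ with ∈-image⁻ c∈
    ... | zero  , here       , refl = x∈p∪q⁺ (inj₁ (x∈⁅x⁆ (φ zero)))
    ... | suc v , there v∈e , refl = x∈p∪q⁺ (inj₂ (∈-image⁺ v∈e))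
    join : ∀ {c} → c ∈ ⁅ φ zero ⁆ ∪ image (φ ∘ suc) e → c ∈ image φ (inside ∷ e)
    join c∈ with x∈p∪q⁻ ⁅ φ zero ⁆ _ c∈
    ... | inj₁ c∈⁅φ0⁆ rewrite x∈⁅y⁆⇒x≡y _ c∈⁅φ0⁆ = ∈-image⁺ here
    ... | inj₂ c∈φ[e] with ∈-image⁻ c∈φ[e]
    ...   | v , v∈e , refl = ∈-image⁺ (there v∈e)

∣image∣≡∣e∣ : ∀ (φ : Fin n → Fin k) e → InjectiveOn φ e → ∣ image φ e ∣ ≡ ∣ e ∣
∣image∣≡∣e∣ {k = k} φ [] _ = trans (cong ∣_∣ image≡⊥) (∣⊥∣≡0 k)
  where
  image≡⊥ : image φ [] ≡ ⊥
  image≡⊥ = Empty-unique λ (c , c∈) → case ∈-image⁻ {φ = φ} {[]} c∈ of λ ()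
∣image∣≡∣e∣ φ (outside ∷ e) inj =
  trans (cong ∣_∣ (image-outside∷ φ e)) (∣image∣≡∣e∣ (φ ∘ suc) e (injective-tail φ inj))
∣image∣≡∣e∣ φ (inside ∷ e) inj = begin
  ∣ image φ (inside ∷ e) ∣                    ≡⟨ cong ∣_∣ (image-inside∷ φ e) ⟩
  ∣ ⁅ φ zero ⁆ ∪ image (φ ∘ suc) e ∣          ≡⟨ ∣p∪q∣≡∣p∣+∣q∣ φ0∉φ[e] ⟩
  ∣ ⁅ φ zero ⁆ ∣ + ∣ image (φ ∘ suc) e ∣      ≡⟨ cong₂ _+_ (∣⁅x⁆∣≡1 (φ zero))
                                                  (∣image∣≡∣e∣ (φ ∘ suc) e (injective-tail φ inj)) ⟩
  suc ∣ e ∣                                  ∎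
  where
  open ≡-Reasoning
  φ0∉φ[e] : Disjoint ⁅ φ zero ⁆ (image (φ ∘ suc) e)
  φ0∉φ[e] c∈⁅φ0⁆ c∈φ[e] with ∈-image⁻ c∈φ[e]
  ... | v , v∈e , φsv≡c with inj (suc v) zero (there v∈e) here (trans φsv≡c (x∈⁅y⁆⇒x≡y _ c∈⁅φ0⁆))
  ...   | ()

-- Links and the exchange argument

-- degree H S ≡ ∣ link H S ∣ holds definitionally.
link : Hypergraph n → Subset n → Subset n
link H S = tabulate (λ w → not (lookup S w) ∧ H (S ∪ ⁅ w ⁆))

∈-link⁻ : ∀ {H : Hypergraph n} {S w} → w ∈ link H S → w ∉ S × (S ∪ ⁅ w ⁆) ∈E H
∈-link⁻ {H = H} {S} {w} w∈link
  with lookup S w in S[w] | H (S ∪ ⁅ w ⁆) | trans (sym (lookup∘tabulate _ w)) ([]=⇒lookup w∈link)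
... | outside | true  | _ = (λ w∈S → case trans (sym ([]=⇒lookup w∈S)) S[w] of λ ()) , refl
... | inside  | _     | ()
... | outside | false | ()

CodegreeAbove : ℕ → Hypergraph n → ℕ → Set
CodegreeAbove r H b = ∀ S → InShadow r H S → b < degree H S

module _ {r} {H : Hypergraph n} (uniform : IsUniform r H) where

  edge-vertex∈shadow : ∀ {e u} → e ∈E H → u ∈ e → InShadow r H (e - u)
  edge-vertex∈shadow {e} {u} e∈H u∈e =
    cong (_∸ 1) (trans (sym (x∈p⇒∣p∣≡1+∣p-x∣ u∈e)) (uniform e e∈H)) , e , e∈H , p─q⊆p e ⁅ u ⁆

  module _ {φ : Fin n → Fin k} (hom : IsHom H φ) {T : Subset k} (codegree : CodegreeAbove r H ∣ φ ⁻¹ ∁ T ∣)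
           {v : Fin n} (φv∈T : φ v ∈ T) where

    private
      OffT : Subset n → ℕ
      OffT e = ∣ e ∩ φ ⁻¹ ∁ T ∣

    exchange-step : ∀ {e u} → e ∈E H → v ∈ e → u ∈ e → φ u ∉ T →
                    ∃ λ e′ → e′ ∈E H × v ∈ e′ × OffT e′ < OffT e
    exchange-step {e} {u} e∈H v∈e u∈e φu∉T = S ∪ ⁅ w ⁆ , S∪w∈H , v∈S∪w , fewer
      where
      S = e - u
      found = ∣p∣<∣q∣⇒q∩∁p≢∅ (φ ⁻¹ ∁ T) (link H S) (codegree S (edge-vertex∈shadow e∈H u∈e))
      w = proj₁ found
      w∈link : w ∈ link H S
      w∈link = proj₁ (x∈p∩q⁻ (link H S) _ (proj₂ found))
      φw∈T : φ w ∈ T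
      φw∈T = x∉∁p⇒x∈p (x∈∁p⇒x∉p (proj₂ (x∈p∩q⁻ (link H S) _ (proj₂ found))) ∘ ∈⁻¹⁺ φ)
      S∪w∈H : (S ∪ ⁅ w ⁆) ∈E H
      S∪w∈H = proj₂ (∈-link⁻ {H = H} w∈link)
      v∈S∪w : v ∈ S ∪ ⁅ w ⁆
      v∈S∪w = x∈p∪q⁺ (inj₁ (x∈p∧x≢y⇒x∈p-y v∈e λ { refl → φu∉T φv∈T }))
      off-colours-shrink : (S ∪ ⁅ w ⁆) ∩ φ ⁻¹ ∁ T ⊆ (e ∩ φ ⁻¹ ∁ T) - u
      off-colours-shrink x∈ with x∈p∩q⁻ (S ∪ ⁅ w ⁆) _ x∈
      ... | x∈S∪w , x∈off with x∈p∪q⁻ S ⁅ w ⁆ x∈S∪w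
      ...   | inj₁ x∈S  = x∈p∧x≢y⇒x∈p-y (x∈p∩q⁺ (p─q⊆p e ⁅ u ⁆ x∈S , x∈off)) (x∈p-y⇒x≢y e x∈S)
      ...   | inj₂ x∈⁅w⁆ rewrite x∈⁅y⁆⇒x≡y w x∈⁅w⁆ = contradiction φw∈T (x∈∁p⇒x∉p (∈⁻¹⁻ φ {∁ T} x∈off))
      fewer : OffT (S ∪ ⁅ w ⁆) < OffT e
      fewer = ≤-<-trans (p⊆q⇒∣p∣≤∣q∣ off-colours-shrink)
                (x∈p⇒∣p-x∣<∣p∣ (x∈p∩q⁺ (u∈e , ∈⁻¹⁺ φ (x∉p⇒x∈∁p φu∉T))))

    exchange : ∀ b {e} → e ∈E H → v ∈ e → OffT e < b →
               ∃ λ e′ → e′ ∈E H × v ∈ e′ × (∀ {x} → x ∈ e′ → φ x ∈ T)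
    exchange (suc b) {e} e∈H v∈e off<b with nonempty? (e ∩ φ ⁻¹ ∁ T)
    ... | no  e⊆φ⁻¹T = e , e∈H , v∈e , λ {x} x∈e →
                          x∉∁p⇒x∈p λ φx∈∁T → e⊆φ⁻¹T (x , x∈p∩q⁺ (x∈e , ∈⁻¹⁺ φ φx∈∁T))
    ... | yes (u , u∈)
      with exchange-step e∈H v∈e (proj₁ (x∈p∩q⁻ e _ u∈)) (x∈∁p⇒x∉p (∈⁻¹⁻ φ (proj₂ (x∈p∩q⁻ e _ u∈))))
    ...   | e′ , e′∈H , v∈e′ , fewer = exchange b e′∈H v∈e′ (<-≤-trans fewer (s≤s⁻¹ off<b))

    edge-with-image : NoIsolated H → ∣ T ∣ ≡ r → Σ (Subset n) λ e → e ∈E H × v ∈ e × image φ e ≡ T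
    edge-with-image noIsolated ∣T∣≡r =
      let e₀ , e₀∈H , v∈e₀ = noIsolated v
          e , e∈H , v∈e , φ[e]⊆T = exchange (suc (OffT e₀)) e₀∈H v∈e₀ ≤-refl
          ∣T∣≡∣φ[e]∣ = trans ∣T∣≡r (sym (trans (∣image∣≡∣e∣ φ e (hom e e∈H)) (uniform e e∈H)))
      in e , e∈H , v∈e , p⊆q⇒∣q∣≤∣p∣⇒p≡q (image⊆ φ[e]⊆T) (≤-reflexive ∣T∣≡∣φ[e]∣)

codegree-scaled : ∀ {r} {H : Hypergraph n} {a b} M → (∀ S → InShadow r H S → a < degree H S * M) →
                  b * M ≤ a → CodegreeAbove r H b
codegree-scaled {H = H} {b = b} M codegree bM≤a S S∈∂H =
  *-cancelʳ-< M b (degree H S) (≤-<-trans bM≤a (codegree S S∈∂H))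

link⊆φ⁻¹∁image : ∀ {H : Hypergraph n} {φ : Fin n → Fin k} → IsHom H φ →
                 ∀ S → link H S ⊆ φ ⁻¹ ∁ (image φ S)
link⊆φ⁻¹∁image {H = H} {φ} hom S {w} w∈link = ∈⁻¹⁺ φ (x∉p⇒x∈∁p φw∉φ[S])
  where
  φw∉φ[S] : φ w ∉ image φ S
  φw∉φ[S] φw∈φ[S] with ∈-image⁻ φw∈φ[S] | ∈-link⁻ {H = H} w∈link
  ... | x , x∈S , φx≡φw | w∉S , S∪w∈H =
    w∉S (subst (_∈ S) (hom (S ∪ ⁅ w ⁆) S∪w∈H x w (p⊆p∪q ⁅ w ⁆ x∈S) (q⊆p∪q S ⁅ w ⁆ (x∈⁅x⁆ w)) φx≡φw)
               x∈S)

module Proposition-2-2 {n k r} (2≤r : 2 ≤ r) (r≤k : r ≤ k) {H : Hypergraph n}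
  (uniform : IsUniform r H) (noIsolated : NoIsolated H)
  (codegree : ∀ S → InShadow r H S → (3 * k + 1 ∸ 3 * r) * n < degree H S * (3 * k ∸ 2))
  {φ : Fin n → Fin k} (hom : IsHom H φ) {i : Fin k} {v : Fin n} (φv≡i : φ v ≡ i) where

  private
    M = 3 * k ∸ 2
    J = Jset φ
    1≤r : 1 ≤ r
    1≤r = ≤-trans (s≤s z≤n) 2≤r

  EdgeOnto : Subset k → Set
  EdgeOnto T = Σ (Subset n) λ e → e ∈E H × v ∈ e × image φ e ≡ T

  edge-onto : ∀ {T} → ∣ T ∣ ≡ r → i ∈ T → CodegreeAbove r H ∣ φ ⁻¹ ∁ T ∣ → EdgeOnto T
  edge-onto ∣T∣≡r i∈T codegree-T =
    edge-with-image uniform hom codegree-T (subst (_∈ _) (sym φv≡i) i∈T) noIsolated ∣T∣≡r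

  edge-onto-light : ∀ {T} → ∣ T ∣ ≡ r → i ∈ T → (∀ {c} → c ∉ T → c ∉ J) → EdgeOnto T
  edge-onto-light ∣T∣≡r i∈T J⊆T =
    edge-onto ∣T∣≡r i∈T (codegree-scaled {r = r} M codegree (light-outside φ ∣T∣≡r J⊆T))

  i∈J⇒edge-onto-J∪I : i ∈ J → ∀ I → I ⊆ ∁ J → ∣ J ∣ + ∣ I ∣ ≡ r → EdgeOnto (J ∪ I)
  i∈J⇒edge-onto-J∪I i∈J I I⊆∁J ∣J∣+∣I∣≡r =
    edge-onto-light (trans (∣p∪q∣≡∣p∣+∣q∣ J#I) ∣J∣+∣I∣≡r) (p⊆p∪q I i∈J) (λ c∉J∪I → c∉J∪I ∘ p⊆p∪q I)
    where
    J#I : Disjoint J I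
    J#I c∈J c∈I = x∈∁p⇒x∉p (I⊆∁J c∈I) c∈J

  i∉J⇒edge-onto-J∪I∪i : i ∉ J → ∀ I → I ⊆ ∁ J → i ∉ I → ∣ J ∣ + ∣ I ∣ + 1 ≡ r → EdgeOnto (J ∪ I ∪ ⁅ i ⁆)
  i∉J⇒edge-onto-J∪I∪i i∉J I I⊆∁J i∉I ∣J∣+∣I∣+1≡r = edge-onto-light ∣T∣≡r i∈T (λ c∉T → c∉T ∘ p⊆p∪q (I ∪ ⁅ i ⁆))
    where
    J#I∪i : Disjoint J (I ∪ ⁅ i ⁆)
    J#I∪i c∈J c∈I∪i with x∈p∪q⁻ I ⁅ i ⁆ c∈I∪i
    ... | inj₁ c∈I  = x∈∁p⇒x∉p (I⊆∁J c∈I) c∈J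
    ... | inj₂ c∈⁅i⁆ = i∉J (subst (_∈ J) (x∈⁅y⁆⇒x≡y i c∈⁅i⁆) c∈J)
    ∣T∣≡r : ∣ J ∪ I ∪ ⁅ i ⁆ ∣ ≡ r
    ∣T∣≡r = begin
      ∣ J ∪ I ∪ ⁅ i ⁆ ∣         ≡⟨ ∣p∪q∣≡∣p∣+∣q∣ J#I∪i ⟩
      ∣ J ∣ + ∣ I ∪ ⁅ i ⁆ ∣     ≡⟨ cong (∣ J ∣ +_) (x∉p⇒∣p∪⁅x⁆∣≡1+∣p∣ i∉I) ⟩
      ∣ J ∣ + suc ∣ I ∣         ≡⟨ +-suc ∣ J ∣ ∣ I ∣ ⟩
      suc (∣ J ∣ + ∣ I ∣)       ≡⟨ +-comm 1 (∣ J ∣ + ∣ I ∣) ⟩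
      ∣ J ∣ + ∣ I ∣ + 1         ≡⟨ ∣J∣+∣I∣+1≡r ⟩
      r                         ∎
      where open ≡-Reasoning
    i∈T : i ∈ J ∪ I ∪ ⁅ i ⁆
    i∈T = q⊆p∪q J _ (q⊆p∪q I ⁅ i ⁆ (x∈⁅x⁆ i))

  J≡⊥⇒edge-covering-I : J ≡ ⊥ → ∀ I → ∣ I ∣ ≡ r ∸ 1 → Σ (Subset n) λ e → e ∈E H × v ∈ e × I ⊆ image φ e
  J≡⊥⇒edge-covering-I J≡⊥ I ∣I∣≡r-1 =
    let e , e∈H , v∈e , φ[e]≡T = edge-onto-light ∣T∣≡r (X⊆T (q⊆p∪q I ⁅ i ⁆ (x∈⁅x⁆ i))) nothing-heavy
    in e , e∈H , v∈e , λ c∈I → subst (_ ∈_) (sym φ[e]≡T) (X⊆T (p⊆p∪q ⁅ i ⁆ c∈I))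
    where
    X = I ∪ ⁅ i ⁆
    ∣X∣≤r : ∣ X ∣ ≤ r
    ∣X∣≤r = ≤-trans (∣p∪q∣≤∣p∣+∣q∣ I ⁅ i ⁆)
              (≤-reflexive (trans (cong₂ _+_ ∣I∣≡r-1 (∣⁅x⁆∣≡1 i)) (m∸n+n≡m 1≤r)))
    extension = ⊆-extend X (r ∸ ∣ X ∣) (≤-trans (≤-reflexive (m+[n∸m]≡n ∣X∣≤r)) r≤k)
    T = proj₁ extension
    X⊆T = proj₁ (proj₂ extension)
    ∣T∣≡r = trans (proj₂ (proj₂ extension)) (m+[n∸m]≡n ∣X∣≤r)
    nothing-heavy : ∀ {c} → c ∉ T → c ∉ J
    nothing-heavy _ c∈J = ∉⊥ (subst (_ ∈_) J≡⊥ c∈J)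

  colours-not-all-heavy : ∀ {Q b} → i ∉ Q → ∣ Q ∣ ≡ r ∸ 1 → (∀ {c} → c ∈ Q → b ≤ classSize φ c) →
                          b * M < 3 * n
  colours-not-all-heavy {Q} {b} i∉Q ∣Q∣≡r-1 Q-heavy = ≰⇒> λ 3n≤bM →
    let e , e∈H , v∈e , φ[e]≡Q∪i =
          edge-onto ∣Q∪i∣≡r (q⊆p∪q Q ⁅ i ⁆ (x∈⁅x⁆ i)) (codegree-beyond 3n≤bM (p⊆p∪q ⁅ i ⁆))
    in <⇒≱ (codegree-beyond 3n≤bM ⊆-refl (e - v) (edge-vertex∈shadow uniform e∈H v∈e)) (degree≤ φ[e]≡Q∪i)
    where
    room-outside : ∀ {D} → Q ⊆ D → ∣ φ ⁻¹ ∁ D ∣ + (r ∸ 1) * b ≤ n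
    room-outside {D} Q⊆D = begin
      ∣ φ ⁻¹ ∁ D ∣ + (r ∸ 1) * b    ≡⟨ cong (λ q → ∣ φ ⁻¹ ∁ D ∣ + q * b) ∣Q∣≡r-1 ⟨
      ∣ φ ⁻¹ ∁ D ∣ + ∣ Q ∣ * b      ≤⟨ +-monoʳ-≤ ∣ φ ⁻¹ ∁ D ∣ (∣C∣*b≤∣φ⁻¹C∣ φ Q Q-heavy) ⟩
      ∣ φ ⁻¹ ∁ D ∣ + ∣ φ ⁻¹ Q ∣     ≤⟨ +-monoʳ-≤ ∣ φ ⁻¹ ∁ D ∣ (p⊆q⇒∣p∣≤∣q∣ (⁻¹-mono φ Q⊆D)) ⟩
      ∣ φ ⁻¹ ∁ D ∣ + ∣ φ ⁻¹ D ∣     ≡⟨ +-comm ∣ φ ⁻¹ ∁ D ∣ ∣ φ ⁻¹ D ∣ ⟩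
      ∣ φ ⁻¹ D ∣ + ∣ φ ⁻¹ ∁ D ∣     ≡⟨ ∣φ⁻¹C∣+∣φ⁻¹∁C∣≡n φ D ⟩
      n                             ∎
      where open ≤-Reasoning
    ∣Q∪i∣≡r : ∣ Q ∪ ⁅ i ⁆ ∣ ≡ r
    ∣Q∪i∣≡r = trans (x∉p⇒∣p∪⁅x⁆∣≡1+∣p∣ i∉Q) (trans (cong suc ∣Q∣≡r-1) (trans (+-comm 1 (r ∸ 1)) (m∸n+n≡m 1≤r)))
    codegree-beyond : 3 * n ≤ b * M → ∀ {D} → Q ⊆ D → CodegreeAbove r H ∣ φ ⁻¹ ∁ D ∣
    codegree-beyond 3n≤bM Q⊆D =
      codegree-scaled {r = r} M codegree (X*[3k∸2]≤[3k+1∸3r]*n n k r 1≤r r≤k 3n≤bM (room-outside Q⊆D))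
    Q⊆φ[e-v] : ∀ {e} → image φ e ≡ Q ∪ ⁅ i ⁆ → Q ⊆ image φ (e - v)
    Q⊆φ[e-v] {e} φ[e]≡Q∪i {c} c∈Q with ∈-image⁻ (subst (c ∈_) (sym φ[e]≡Q∪i) (p⊆p∪q ⁅ i ⁆ c∈Q))
    ... | x , x∈e , refl = ∈-image⁺ (x∈p∧x≢y⇒x∈p-y x∈e λ { refl → i∉Q (subst (_∈ Q) φv≡i c∈Q) })
    degree≤ : ∀ {e} → image φ e ≡ Q ∪ ⁅ i ⁆ → degree H (e - v) ≤ ∣ φ ⁻¹ ∁ Q ∣
    degree≤ {e} φ[e]≡Q∪i = p⊆q⇒∣p∣≤∣q∣
      (⊆-trans (link⊆φ⁻¹∁image hom (e - v)) (⁻¹-mono φ (p⊆q⇒∁p⊇∁q (Q⊆φ[e-v] φ[e]≡Q∪i))))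

  heaviest-outside-heavy : ∀ {T} → ∣ T ∣ ≡ r → ∀ S → InShadow r H S → degree H S ≤ ∣ φ ⁻¹ ∁ T ∣ →
    ∃ λ c → c ∉ T × 3 * n < classSize φ c * M × (∀ {c′} → c′ ∉ T → classSize φ c′ ≤ classSize φ c)
  heaviest-outside-heavy {T} ∣T∣≡r S S∈∂H degree≤ = c , x∈∁p⇒x∉p c∈∁T , heavy , c-max ∘ x∉p⇒x∈∁p
    where
    0<degree : 0 < degree H S
    0<degree = n≢0⇒n>0 λ degree≡0 → n≮0 (subst (λ d → _ < d * M) degree≡0 (codegree S S∈∂H))
    coloured-outside = ∣p∣<∣q∣⇒q∩∁p≢∅ ⊥ (φ ⁻¹ ∁ T)
                         (subst (_< ∣ φ ⁻¹ ∁ T ∣) (sym (∣⊥∣≡0 n)) (<-≤-trans 0<degree degree≤))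
    best = argmax-on (classSize φ) (∈⁻¹⁻ φ (proj₁ (x∈p∩q⁻ _ (∁ ⊥) (proj₂ coloured-outside))))
    c = proj₁ best
    c∈∁T = proj₁ (proj₂ best)
    c-max = proj₂ (proj₂ best)
    outside≤ : ∣ φ ⁻¹ ∁ T ∣ * M ≤ (k ∸ r) * (classSize φ c * M)
    outside≤ = begin
      ∣ φ ⁻¹ ∁ T ∣ * M                ≡⟨ cong (_* M) (*-identityʳ ∣ φ ⁻¹ ∁ T ∣) ⟨
      ∣ φ ⁻¹ ∁ T ∣ * 1 * M            ≤⟨ *-monoˡ-≤ M (∣φ⁻¹C∣*w≤∣C∣*b φ (∁ T) c-max*1) ⟩
      ∣ ∁ T ∣ * classSize φ c * M     ≡⟨ cong (λ t → t * classSize φ c * M) ∣∁T∣≡k-r ⟩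
      (k ∸ r) * classSize φ c * M     ≡⟨ *-assoc (k ∸ r) (classSize φ c) M ⟩
      (k ∸ r) * (classSize φ c * M)   ∎
      where
      open ≤-Reasoning
      c-max*1 : ∀ {c′} → c′ ∈ ∁ T → classSize φ c′ * 1 ≤ classSize φ c
      c-max*1 {c′} c′∈∁T = subst (_≤ classSize φ c) (sym (*-identityʳ (classSize φ c′))) (c-max c′∈∁T)
      ∣∁T∣≡k-r = trans (∣∁p∣≡n∸∣p∣ T) (cong (k ∸_) ∣T∣≡r)
    heavy : 3 * n < classSize φ c * M
    heavy = *-cancelˡ-< (k ∸ r) _ _ (begin-strict
      (k ∸ r) * (3 * n)               ≤⟨ [k∸r]*3x≤[3k+1∸3r]*x k r n ⟩
      (3 * k + 1 ∸ 3 * r) * n         <⟨ codegree S S∈∂H ⟩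
      degree H S * M                  ≤⟨ *-monoˡ-≤ M degree≤ ⟩
      ∣ φ ⁻¹ ∁ T ∣ * M                ≤⟨ outside≤ ⟩
      (k ∸ r) * (classSize φ c * M)   ∎)
      where open ≤-Reasoning

  codegree-beside-heaviest : ∀ {T P} → ∣ T ∣ ≡ r → i ∈ T → P ⊆ T → i ∉ P → ∣ P ∣ ≡ r ∸ 2 →
    (∀ {c c′} → c ∈ P → c′ ∉ T → classSize φ c′ ≤ classSize φ c) → CodegreeAbove r H ∣ φ ⁻¹ ∁ T ∣
  codegree-beside-heaviest {T} {P} ∣T∣≡r i∈T P⊆T i∉P ∣P∣≡r-2 P-heaviest S S∈∂H
    with ∣ φ ⁻¹ ∁ T ∣ <? degree H S
  ... | yes below = below
  ... | no  not-below =
    let c , c∉T , heavy , _ = heaviest-outside-heavy ∣T∣≡r S S∈∂H (≮⇒≥ not-below)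
        c∉P = c∉T ∘ P⊆T
        i∉P∪c : i ∉ P ∪ ⁅ c ⁆
        i∉P∪c i∈ = case x∈p∪q⁻ P ⁅ c ⁆ i∈ of λ where
          (inj₁ i∈P)  → i∉P i∈P
          (inj₂ i∈⁅c⁆) → c∉T (subst (_∈ T) (x∈⁅y⁆⇒x≡y c i∈⁅c⁆) i∈T)
        P∪c-heavy : ∀ {c′} → c′ ∈ P ∪ ⁅ c ⁆ → classSize φ c ≤ classSize φ c′
        P∪c-heavy c′∈ = case x∈p∪q⁻ P ⁅ c ⁆ c′∈ of λ where
          (inj₁ c′∈P)  → P-heaviest c′∈P c∉T
          (inj₂ c′∈⁅c⁆) → ≤-reflexive (cong (classSize φ) (sym (x∈⁅y⁆⇒x≡y c c′∈⁅c⁆)))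
        ∣P∪c∣≡r-1 = trans (x∉p⇒∣p∪⁅x⁆∣≡1+∣p∣ c∉P) (trans (cong suc ∣P∣≡r-2) (sym (+-∸-assoc 1 2≤r)))
    in contradiction heavy (<-asym (colours-not-all-heavy i∉P∪c ∣P∪c∣≡r-1 P∪c-heavy))

  edge-with-j-and-heaviest-colours : ∀ j → j ≢ i → Σ (Subset n) λ e → e ∈E H × v ∈ e × j ∈ image φ e
    × (∀ ℓ ℓ′ → ℓ ∈ image φ e → ℓ ≢ i → ℓ ≢ j → ℓ′ ∉ image φ e → classSize φ ℓ′ ≤ classSize φ ℓ)
  edge-with-j-and-heaviest-colours j j≢i =
    let e , e∈H , v∈e , φ[e]≡T = edge-onto ∣T∣≡r i∈T (codegree-beside-heaviest ∣T∣≡r i∈T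
                                   (p⊆p∪q ij) i∉P ∣P∣≡r-2 dominates)
    in e , e∈H , v∈e , subst (j ∈_) (sym φ[e]≡T) j∈T ,
       λ ℓ ℓ′ ℓ∈φ[e] ℓ≢i ℓ≢j ℓ′∉φ[e] →
         dominates (other-colours-in-P (subst (ℓ ∈_) φ[e]≡T ℓ∈φ[e]) ℓ≢i ℓ≢j)
                   (ℓ′∉φ[e] ∘ subst (ℓ′ ∈_) (sym φ[e]≡T))
    where
    ij = ⁅ i ⁆ ∪ ⁅ j ⁆
    R = ∁ ij
    ∣ij∣≡2 : ∣ ij ∣ ≡ 2
    ∣ij∣≡2 = trans (x∉p⇒∣p∪⁅x⁆∣≡1+∣p∣ (x≢y⇒x∉⁅y⁆ j≢i)) (cong suc (∣⁅x⁆∣≡1 i))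
    r-2≤∣R∣ : r ∸ 2 ≤ ∣ R ∣
    r-2≤∣R∣ = subst (r ∸ 2 ≤_) (sym (trans (∣∁p∣≡n∸∣p∣ ij) (cong (k ∸_) ∣ij∣≡2))) (∸-monoˡ-≤ 2 r≤k)
    chosen = heaviest (classSize φ) R (r ∸ 2) r-2≤∣R∣
    P = proj₁ chosen
    P⊆R = proj₁ (proj₁ (proj₂ chosen))
    P-heaviest = proj₂ (proj₁ (proj₂ chosen))
    ∣P∣≡r-2 = proj₂ (proj₂ chosen)
    T = P ∪ ij
    ∣T∣≡r : ∣ T ∣ ≡ r
    ∣T∣≡r = trans (∣p∪q∣≡∣p∣+∣q∣ (x∈∁p⇒x∉p ∘ P⊆R)) (trans (cong₂ _+_ ∣P∣≡r-2 ∣ij∣≡2) (m∸n+n≡m 2≤r))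
    i∈T : i ∈ T
    i∈T = q⊆p∪q P ij (p⊆p∪q ⁅ j ⁆ (x∈⁅x⁆ i))
    j∈T : j ∈ T
    j∈T = q⊆p∪q P ij (q⊆p∪q ⁅ i ⁆ ⁅ j ⁆ (x∈⁅x⁆ j))
    i∉P : i ∉ P
    i∉P i∈P = x∈∁p⇒x∉p (P⊆R i∈P) (p⊆p∪q ⁅ j ⁆ (x∈⁅x⁆ i))
    dominates : ∀ {c c′} → c ∈ P → c′ ∉ T → classSize φ c′ ≤ classSize φ c
    dominates c∈P c′∉T = P-heaviest c∈P (x∉p⇒x∈∁p (c′∉T ∘ q⊆p∪q P ij)) (c′∉T ∘ p⊆p∪q ij)
    other-colours-in-P : ∀ {ℓ} → ℓ ∈ T → ℓ ≢ i → ℓ ≢ j → ℓ ∈ P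
    other-colours-in-P ℓ∈T ℓ≢i ℓ≢j with x∈p∪q⁻ P ij ℓ∈T
    ... | inj₁ ℓ∈P  = ℓ∈P
    ... | inj₂ ℓ∈ij with x∈p∪q⁻ ⁅ i ⁆ ⁅ j ⁆ ℓ∈ij
    ...   | inj₁ ℓ∈⁅i⁆ = contradiction (x∈⁅y⁆⇒x≡y i ℓ∈⁅i⁆) ℓ≢i
    ...   | inj₂ ℓ∈⁅j⁆ = contradiction (x∈⁅y⁆⇒x≡y j ℓ∈⁅j⁆) ℓ≢j

proposition2p2 : (n k r : ℕ) → 2 ≤ r → r ≤ k → k ≤ n →
  (H : Hypergraph n) → IsUniform r H → NoIsolated H →
  (∀ S → InShadow r H S →
      ((3 * k + 1 ∸ 3 * r) * n < degree H S * (3 * k ∸ 2))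
    × ((k + 1 ∸ r) * n < degree H S * (k + 2))) →
  (φ : Fin n → Fin k) → IsHom H φ →
  (i : Fin k) (v : Fin n) → φ v ≡ i →
    (i ∈ Jset φ → ∀ (I : Subset k) → I ⊆ ∁ (Jset φ) → ∣ Jset φ ∣ + ∣ I ∣ ≡ r →
      Σ (Subset n) λ e → e ∈E H × v ∈ e × image φ e ≡ Jset φ ∪ I)
  × (i ∉ Jset φ → ∀ (I : Subset k) → I ⊆ ∁ (Jset φ) → i ∉ I →
      ∣ Jset φ ∣ + ∣ I ∣ + 1 ≡ r →
      Σ (Subset n) λ e → e ∈E H × v ∈ e × image φ e ≡ Jset φ ∪ I ∪ ⁅ i ⁆)
  × (∀ (j : Fin k) → j ≢ i →
      Σ (Subset n) λ e → e ∈E H × v ∈ e × j ∈ image φ e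
        × (∀ ℓ ℓ′ → ℓ ∈ image φ e → ℓ ≢ i → ℓ ≢ j → ℓ′ ∉ image φ e →
             classSize φ ℓ′ ≤ classSize φ ℓ))
  × (Jset φ ≡ ⊥ → ∀ (I : Subset k) → ∣ I ∣ ≡ r ∸ 1 →
      Σ (Subset n) λ e → e ∈E H × v ∈ e × I ⊆ image φ e)
proposition2p2 n k r 2≤r r≤k _ H uniform noIsolated codegree φ hom i v φv≡i =
  i∈J⇒edge-onto-J∪I , i∉J⇒edge-onto-J∪I∪i , edge-with-j-and-heaviest-colours , J≡⊥⇒edge-covering-I
  where
  open Proposition-2-2 2≤r r≤k uniform noIsolated (λ S S∈∂H → proj₁ (codegree S S∈∂H)) hom φv≡i
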